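{- Let $(Q,\le,\cdot,1,\textit{dom},\textit{cod})$ be a modal quantale with $Q_{\textit{dom}}$, $|\alpha\rangle$, $\langle\alpha|$, $[\alpha|$, $|\alpha]$ as defined below. Then for all $\alpha\in Q$ and $\rho,\sigma\in Q_{\textit{dom}}$: $|\alpha\rangle\rho\le\sigma\iff\alpha\cdot\rho\le\sigma\cdot\alpha$; $\ \langle\alpha|\rho\le\sigma\iff\rho\cdot\alpha\le\alpha\cdot\sigma$; $\ \rho\le|\alpha]\sigma\iff\rho\cdot\alpha\le\alpha\cdot\sigma$; $\ \rho\le[\alpha|\sigma\iff\alpha\cdot\rho\le\sigma\cdot\alpha$.
   Context: A modal quantale is a complete lattice $(Q,\le)$ (least element $\bot$, binary sup $\vee$) with an associative operation $\cdot$ with two-sided unit $1$ preserving arbitrary sups in each argument, and maps $\textit{dom},\textit{cod}:Q\to Q$ such that for all $\alpha,\beta$: $\alpha\le\textit{dom}(\alpha)\cdot\alpha$, $\textit{dom}(\alpha\cdot\textit{dom}(\beta))=\textit{dom}(\alpha\cdot\beta)$, $\textit{dom}(\alpha)\le1$, $\textit{dom}(\bot)=\bot$, $\textit{dom}(\alpha\vee\beta)=\textit{dom}(\alpha)\vee\textit{dom}(\beta)$; the opposite axioms for $\textit{cod}$ ($\alpha\le\alpha\cdot\textit{cod}(\alpha)$, $\textit{cod}(\textit{cod}(\alpha)\cdot\beta)=\textit{cod}(\alpha\cdot\beta)$, $\textit{cod}(\alpha)\le1$, $\textit{cod}(\bot)=\bot$, $\textit{cod}(\alpha\vee\beta)=\textit{cod}(\alpha)\vee\textit{cod}(\beta)$);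 and $\textit{dom}\circ\textit{cod}=\textit{cod}$, $\textit{cod}\circ\textit{dom}=\textit{dom}$. $Q_{\textit{dom}}=\{\alpha\in Q\mid\textit{dom}(\alpha)=\alpha\}$. For $\alpha\in Q$, $\rho\in Q_{\textit{dom}}$: $|\alpha\rangle\rho=\textit{dom}(\alpha\cdot\rho)$, $\langle\alpha|\rho=\textit{cod}(\rho\cdot\alpha)$, $[\alpha|\rho=\bigvee\{\sigma\in Q_{\textit{dom}}\mid|\alpha\rangle\sigma\le\rho\}$, $|\alpha]\rho=\bigvee\{\sigma\in Q_{\textit{dom}}\mid\langle\alpha|\sigma\le\rho\}$. -}

module Defs where

open import Level using (Level; suc; _⊔_)
open import Data.Product using (Σ; _×_; _,_; proj₁)
open import Relation.Binary.PropositionalEquality using (_≡_)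
open import Relation.Binary.Structures using (IsPartialOrder)

-- Equality is propositional equality on the carrier;
-- (Q, ≤) is a complete lattice given by a partial order with arbitrary
-- sups ⋁ over families indexed by any type I : Set (c ⊔ ℓ)
-- (large enough to index all subsets of Q).  ⊥ and binary ∨ are the
-- corresponding special sups, included as fields with their defining laws.
record ModalQuantale (c ℓ : Level) : Set (suc (c ⊔ ℓ)) where
  infixl 7 _·_
  infix  4 _≤_
  infixl 6 _∨_
  field
    Q     : Set c
    _≤_   : Q → Q → Set ℓ
    isPartialOrder : IsPartialOrder _≡_ _≤_
    ⋁     : {I : Set (c ⊔ ℓ)} → (I → Q) → Q
    ⋁-upper : {I : Set (c ⊔ ℓ)} (f : I → Q) (i : I) → f i ≤ ⋁ f
    ⋁-least : {I : Set (c ⊔ ℓ)} (f : I → Q) (x : Q) → ((i : I) → f i ≤ x) → ⋁ f ≤ x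
    ⊥     : Q
    ⊥-least : (x : Q) → ⊥ ≤ x
    _∨_   : Q → Q → Q
    ∨-upperˡ : (x y : Q) → x ≤ x ∨ y
    ∨-upperʳ : (x y : Q) → y ≤ x ∨ y
    ∨-least  : (x y z : Q) → x ≤ z → y ≤ z → x ∨ y ≤ z
    _·_   : Q → Q → Q
    𝟙     : Q
    ·-assoc : (x y z : Q) → (x · y) · z ≡ x · (y · z)
    ·-identityˡ : (x : Q) → 𝟙 · x ≡ x
    ·-identityʳ : (x : Q) → x · 𝟙 ≡ x
    ·-⋁-distribˡ : {I : Set (c ⊔ ℓ)} (x : Q) (f : I → Q) → x · ⋁ f ≡ ⋁ (λ i → x · f i)
    ·-⋁-distribʳ : {I : Set (c ⊔ ℓ)} (f : I → Q) (x : Q) → ⋁ f · x ≡ ⋁ (λ i → f i · x)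
    dom cod : Q → Q
    dom-absorb  : (α : Q) → α ≤ dom α · α
    dom-local   : (α β : Q) → dom (α · dom β) ≡ dom (α · β)
    dom-sub-id  : (α : Q) → dom α ≤ 𝟙
    dom-strict  : dom ⊥ ≡ ⊥
    dom-add     : (α β : Q) → dom (α ∨ β) ≡ dom α ∨ dom β
    cod-absorb  : (α : Q) → α ≤ α · cod α
    cod-local   : (α β : Q) → cod (cod α · β) ≡ cod (α · β)
    cod-sub-id  : (α : Q) → cod α ≤ 𝟙
    cod-strict  : cod ⊥ ≡ ⊥
    cod-add     : (α β : Q) → cod (α ∨ β) ≡ cod α ∨ cod β
    dom-cod     : (α : Q) → dom (cod α) ≡ cod α
    cod-dom     : (α : Q) → cod (dom α) ≡ dom α

  Qdom : Set c
  Qdom = Σ Q (λ α → dom α ≡ α)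

  ∣_⟩_ : Q → Qdom → Q
  ∣ α ⟩ ρ = dom (α · proj₁ ρ)

  ⟨_∣_ : Q → Qdom → Q
  ⟨ α ∣ ρ = cod (proj₁ ρ · α)

  [_∣_ : Q → Qdom → Q
  [ α ∣ ρ = ⋁ {I = Σ Qdom (λ σ → ∣ α ⟩ σ ≤ proj₁ ρ)} (λ p → proj₁ (proj₁ p))

  ∣_]_ : Q → Qdom → Q
  ∣ α ] ρ = ⋁ {I = Σ Qdom (λ σ → ⟨ α ∣ σ ≤ proj₁ ρ)} (λ p → proj₁ (proj₁ p))

{-# OPTIONS --safe #-}
module Submission where

-- The diamond inequalities come from absorption, α ≤ dom α · α, together with
-- locality, which gives dom (σ · α) ≤ dom σ (and dually for cod).  Through
-- them, |α]σ and [α|σ become sups of all ρ ∈ Q_dom with ρ · α ≤ α · σ,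
-- resp. α · ρ ≤ σ · α; since · distributes over ⋁ these conditions are
-- closed under sups, so each box is the greatest such ρ.

open import Defs
open import Level using (Level; Lift; lift; _⊔_)
open import Data.Bool using (Bool; true; false)
open import Data.Product using (_×_; _,_; proj₁)
open import Function.Bundles using (_⇔_; mk⇔; Equivalence)
open import Relation.Binary.Bundles using (Poset)
open import Relation.Binary.Structures using (IsPartialOrder)
open import Relation.Binary.PropositionalEquality using (_≡_; sym; trans; cong)

module ModalQuantaleProperties {c ℓ : Level} (M : ModalQuantale c ℓ) where
  open ModalQuantale M
  open IsPartialOrder isPartialOrder using (antisym) renaming (refl to ≤-refl; trans to ≤-trans)

  poset : Poset c c ℓ
  poset = record { isPartialOrder = isPartialOrder }

  open import Relation.Binary.Reasoning.PartialOrder poset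

  -- Multiplication is only assumed to preserve ⋁, not ∨, so monotonicity of ·
  -- is obtained through this two-element family.
  pair : Q → Q → Lift (c ⊔ ℓ) Bool → Q
  pair x y (lift false) = x
  pair x y (lift true)  = y

  ⋁-pair : ∀ {x y} → x ≤ y → ⋁ (pair x y) ≡ y
  ⋁-pair {x} {y} x≤y = antisym (⋁-least (pair x y) y below) (⋁-upper (pair x y) (lift true))
    where
    below : ∀ i → pair x y i ≤ y
    below (lift false) = x≤y
    below (lift true)  = ≤-refl

  ·-monoʳ-≤ : ∀ z {x y} → x ≤ y → z · x ≤ z · y
  ·-monoʳ-≤ z {x} {y} x≤y = begin
    z · x                     ≤⟨ ⋁-upper (λ i → z · pair x y i) (lift false) ⟩
    ⋁ (λ i → z · pair x y i)  ≡⟨ sym (·-⋁-distribˡ z (pair x y)) ⟩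
    z · ⋁ (pair x y)          ≡⟨ cong (z ·_) (⋁-pair x≤y) ⟩
    z · y                     ∎

  ·-monoˡ-≤ : ∀ z {x y} → x ≤ y → x · z ≤ y · z
  ·-monoˡ-≤ z {x} {y} x≤y = begin
    x · z                     ≤⟨ ⋁-upper (λ i → pair x y i · z) (lift false) ⟩
    ⋁ (λ i → pair x y i · z)  ≡⟨ sym (·-⋁-distribʳ (pair x y) z) ⟩
    ⋁ (pair x y) · z          ≡⟨ cong (_· z) (⋁-pair x≤y) ⟩
    y · z                     ∎

  x·p≤x : ∀ x {p} → p ≤ 𝟙 → x · p ≤ x
  x·p≤x x {p} p≤𝟙 = begin
    x · p  ≤⟨ ·-monoʳ-≤ x p≤𝟙 ⟩
    x · 𝟙  ≡⟨ ·-identityʳ x ⟩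
    x      ∎

  p·x≤x : ∀ x {p} → p ≤ 𝟙 → p · x ≤ x
  p·x≤x x {p} p≤𝟙 = begin
    p · x  ≤⟨ ·-monoˡ-≤ x p≤𝟙 ⟩
    𝟙 · x  ≡⟨ ·-identityˡ x ⟩
    x      ∎

  ⋁-·-least : ∀ {I : Set (c ⊔ ℓ)} (f : I → Q) {x y} → (∀ i → f i · x ≤ y) → ⋁ f · x ≤ y
  ⋁-·-least f {x} {y} below = begin
    ⋁ f · x            ≡⟨ ·-⋁-distribʳ f x ⟩
    ⋁ (λ i → f i · x)  ≤⟨ ⋁-least _ y below ⟩
    y                  ∎

  ·-⋁-least : ∀ {I : Set (c ⊔ ℓ)} (f : I → Q) {x y} → (∀ i → x · f i ≤ y) → x · ⋁ f ≤ y
  ·-⋁-least f {x} {y} below = begin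
    x · ⋁ f            ≡⟨ ·-⋁-distribˡ x f ⟩
    ⋁ (λ i → x · f i)  ≤⟨ ⋁-least _ y below ⟩
    y                  ∎

  x≤y⇒x∨y≡y : ∀ {x y} → x ≤ y → x ∨ y ≡ y
  x≤y⇒x∨y≡y {x} {y} x≤y = antisym (∨-least x y y x≤y ≤-refl) (∨-upperʳ x y)

  dom-mono : ∀ {x y} → x ≤ y → dom x ≤ dom y
  dom-mono {x} {y} x≤y = begin
    dom x          ≤⟨ ∨-upperˡ (dom x) (dom y) ⟩
    dom x ∨ dom y  ≡⟨ sym (dom-add x y) ⟩
    dom (x ∨ y)    ≡⟨ cong dom (x≤y⇒x∨y≡y x≤y) ⟩
    dom y          ∎

  cod-mono : ∀ {x y} → x ≤ y → cod x ≤ cod y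
  cod-mono {x} {y} x≤y = begin
    cod x          ≤⟨ ∨-upperˡ (cod x) (cod y) ⟩
    cod x ∨ cod y  ≡⟨ sym (cod-add x y) ⟩
    cod (x ∨ y)    ≡⟨ cong cod (x≤y⇒x∨y≡y x≤y) ⟩
    cod y          ∎

  dom-·-≤ : ∀ x α → dom (x · α) ≤ dom x
  dom-·-≤ x α = begin
    dom (x · α)      ≡⟨ sym (dom-local x α) ⟩
    dom (x · dom α)  ≤⟨ dom-mono (x·p≤x x (dom-sub-id α)) ⟩
    dom x            ∎

  cod-·-≤ : ∀ α x → cod (α · x) ≤ cod x
  cod-·-≤ α x = begin
    cod (α · x)      ≡⟨ sym (cod-local α x) ⟩
    cod (cod α · x)  ≤⟨ cod-mono (p·x≤x x (cod-sub-id α)) ⟩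
    cod x            ∎

  Qdom-≤𝟙 : (ρ : Qdom) → proj₁ ρ ≤ 𝟙
  Qdom-≤𝟙 (r , dom-r≡r) = begin
    r      ≡⟨ sym dom-r≡r ⟩
    dom r  ≤⟨ dom-sub-id r ⟩
    𝟙      ∎

  Qdom-cod : (ρ : Qdom) → cod (proj₁ ρ) ≡ proj₁ ρ
  Qdom-cod (r , dom-r≡r) = trans (cong cod (sym dom-r≡r)) (trans (cod-dom r) dom-r≡r)

  ∣⟩-≤⇔ : (α : Q) (ρ σ : Qdom) → (∣ α ⟩ ρ ≤ proj₁ σ) ⇔ (α · proj₁ ρ ≤ proj₁ σ · α)
  ∣⟩-≤⇔ α ρ σ@(s , dom-s≡s) = mk⇔ to from
    where
    r = proj₁ ρ
    to : dom (α · r) ≤ s → α · r ≤ s · α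
    to dom-αr≤s = begin
      α · r                  ≤⟨ dom-absorb (α · r) ⟩
      dom (α · r) · (α · r)  ≤⟨ ·-monoˡ-≤ (α · r) dom-αr≤s ⟩
      s · (α · r)            ≤⟨ ·-monoʳ-≤ s (x·p≤x α (Qdom-≤𝟙 ρ)) ⟩
      s · α                  ∎
    from : α · r ≤ s · α → dom (α · r) ≤ s
    from αr≤sα = begin
      dom (α · r)  ≤⟨ dom-mono αr≤sα ⟩
      dom (s · α)  ≤⟨ dom-·-≤ s α ⟩
      dom s        ≡⟨ dom-s≡s ⟩
      s            ∎

  ⟨∣-≤⇔ : (α : Q) (ρ σ : Qdom) → (⟨ α ∣ ρ ≤ proj₁ σ) ⇔ (proj₁ ρ · α ≤ α · proj₁ σ)
  ⟨∣-≤⇔ α ρ σ = mk⇔ to from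
    where
    r = proj₁ ρ
    s = proj₁ σ
    to : cod (r · α) ≤ s → r · α ≤ α · s
    to cod-rα≤s = begin
      r · α                  ≤⟨ cod-absorb (r · α) ⟩
      (r · α) · cod (r · α)  ≤⟨ ·-monoʳ-≤ (r · α) cod-rα≤s ⟩
      (r · α) · s            ≡⟨ ·-assoc r α s ⟩
      r · (α · s)            ≤⟨ p·x≤x (α · s) (Qdom-≤𝟙 ρ) ⟩
      α · s                  ∎
    from : r · α ≤ α · s → cod (r · α) ≤ s
    from rα≤αs = begin
      cod (r · α)  ≤⟨ cod-mono rα≤αs ⟩
      cod (α · s)  ≤⟨ cod-·-≤ α s ⟩
      cod s        ≡⟨ Qdom-cod σ ⟩
      s            ∎

  ≤-∣]⇔ : (α : Q) (ρ σ : Qdom) → (proj₁ ρ ≤ ∣ α ] σ) ⇔ (proj₁ ρ · α ≤ α · proj₁ σ)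
  ≤-∣]⇔ α ρ σ = mk⇔ to from
    where
    to : proj₁ ρ ≤ ∣ α ] σ → proj₁ ρ · α ≤ α · proj₁ σ
    to ρ≤box = ≤-trans (·-monoˡ-≤ α ρ≤box)
      (⋁-·-least _ λ (τ , ⟨α∣τ⟩≤σ) → Equivalence.to (⟨∣-≤⇔ α τ σ) ⟨α∣τ⟩≤σ)
    from : proj₁ ρ · α ≤ α · proj₁ σ → proj₁ ρ ≤ ∣ α ] σ
    from ρα≤ασ = ⋁-upper _ (ρ , Equivalence.from (⟨∣-≤⇔ α ρ σ) ρα≤ασ)

  ≤-[∣⇔ : (α : Q) (ρ σ : Qdom) → (proj₁ ρ ≤ [ α ∣ σ) ⇔ (α · proj₁ ρ ≤ proj₁ σ · α)
  ≤-[∣⇔ α ρ σ = mk⇔ to from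
    where
    to : proj₁ ρ ≤ [ α ∣ σ → α · proj₁ ρ ≤ proj₁ σ · α
    to ρ≤box = ≤-trans (·-monoʳ-≤ α ρ≤box)
      (·-⋁-least _ λ (τ , ∣α⟩τ≤σ) → Equivalence.to (∣⟩-≤⇔ α τ σ) ∣α⟩τ≤σ)
    from : α · proj₁ ρ ≤ proj₁ σ · α → proj₁ ρ ≤ [ α ∣ σ
    from αρ≤σα = ⋁-upper _ (ρ , Equivalence.from (∣⟩-≤⇔ α ρ σ) αρ≤σα)

lemma11p5 : {c ℓ : Level} (M : ModalQuantale c ℓ) →
    let open ModalQuantale M in
    (α : Q) (ρ σ : Qdom) →
      ((∣ α ⟩ ρ ≤ proj₁ σ) ⇔ (α · proj₁ ρ ≤ proj₁ σ · α))
      × ((⟨ α ∣ ρ ≤ proj₁ σ) ⇔ (proj₁ ρ · α ≤ α · proj₁ σ))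
      × ((proj₁ ρ ≤ ∣ α ] σ) ⇔ (proj₁ ρ · α ≤ α · proj₁ σ))
      × ((proj₁ ρ ≤ [ α ∣ σ) ⇔ (α · proj₁ ρ ≤ proj₁ σ · α))
lemma11p5 M α ρ σ = ∣⟩-≤⇔ α ρ σ , ⟨∣-≤⇔ α ρ σ , ≤-∣]⇔ α ρ σ , ≤-[∣⇔ α ρ σ
  where open ModalQuantaleProperties M
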